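{- Let $M$ be a finite multiplicative subgroup of a field $\mathbb{E}$ with $|M|=r^e$, where $r$ is a prime and $e\geq1$. Then $M$ is never automatically non-standard.
   Context: Let $p$ be the characteristic of $\mathbb{E}$ and $m>1$ with $(m,p)=1$ if $p>0$. $\phi_{p,m}$ denotes the $m$th cyclotomic polynomial $\phi_m(x)\in\mathbb{Z}[x]$ (defined by $x^m-1=\prod_{d\mid m}\phi_d(x)$), reduced modulo $p$ if $p>0$; its zeros are exactly the primitive $m$th roots of unity. A subgroup $M$ of size $m$ is called automatically non-standard if it can be listed as $M=\{s_0,\ldots,s_{m-1}\}$ such that $\phi_{p,m}(x)$ divides $\tilde{s}(x)=s_0x^{m-1}+s_1x^{m-2}+\cdots+s_{m-2}x+s_{m-1}$. (Equivalently, in terms of recurrences: there is a polynomial $f$ dividing $(x^m-1)/((x-1)\phi_{p,m}(x))$ and a sequence $s$ with $s_n=c_{k-1}s_{n-1}+\cdots+c_0s_{n-k}$ for all $n$, where $f=x^k-c_{k-1}x^{k-1}-\cdots-c_0$, such that $M=\{s_0,\ldots,s_{m-1}\}$.) -}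

module Defs where

open import Level using (Level; _⊔_) renaming (suc to lsuc)
open import Algebra.Bundles using (CommutativeRing)
open import Data.Nat using (ℕ; zero; suc; _≤_)
open import Data.Nat.Divisibility using (_∣?_)
open import Data.Integer using (ℤ; +_; -[1+_])
open import Data.Integer.Properties using (+-*-commutativeRing)
open import Data.List using (List; []; _∷_; map; foldr; filter; upTo; tabulate; reverse; replicate; _++_)
open import Data.Fin using (Fin)
open import Data.Fin.Permutation using (Permutation′; _⟨$⟩ʳ_)
open import Data.Product using (∃; _,_)
open import Relation.Binary.PropositionalEquality using (_≡_)
open import Relation.Nullary using (¬_)

-- Polynomials over a commutative ring, as coefficient lists
-- (lowest degree first); equality is coefficientwise, so trailing
-- zeros are irrelevant.

module Poly {c ℓ} (R : CommutativeRing c ℓ) where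
  open CommutativeRing R

  Pol : Set c
  Pol = List Carrier

  coeff : Pol → ℕ → Carrier
  coeff []       _       = 0#
  coeff (a ∷ p)  zero    = a
  coeff (a ∷ p)  (suc i) = coeff p i

  infix 4 _≈ₚ_
  _≈ₚ_ : Pol → Pol → Set ℓ
  p ≈ₚ q = ∀ i → coeff p i ≈ coeff q i

  infixl 6 _+ₚ_
  _+ₚ_ : Pol → Pol → Pol
  []      +ₚ q       = q
  (a ∷ p) +ₚ []      = a ∷ p
  (a ∷ p) +ₚ (b ∷ q) = (a + b) ∷ (p +ₚ q)

  infixl 7 _*ₚ_
  _*ₚ_ : Pol → Pol → Pol
  []      *ₚ q = []
  (a ∷ p) *ₚ q = map (a *_) q +ₚ (0# ∷ (p *ₚ q))

  oneₚ : Pol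
  oneₚ = 1# ∷ []

  prodₚ : List Pol → Pol
  prodₚ = foldr _*ₚ_ oneₚ

  xPow : ℕ → Pol
  xPow m = replicate m 0# ++ (1# ∷ [])

  xPowMinusOne : ℕ → Pol
  xPowMinusOne m = xPow m +ₚ ((- 1#) ∷ [])

  infix 4 _∣ₚ_
  _∣ₚ_ : Pol → Pol → Set (c ⊔ ℓ)
  f ∣ₚ g = ∃ λ q → f *ₚ q ≈ₚ g

-- Cyclotomic polynomials over ℤ, via their defining property
--   x^m - 1 = ∏_{d ∣ m} φ_d(x)   for all m ≥ 1.

module ℤPoly = Poly +-*-commutativeRing

divisors : ℕ → List ℕ
divisors m = filter (_∣? m) (upTo (suc m))

IsCyclotomicFamily : (ℕ → List ℤ) → Set
IsCyclotomicFamily Φ =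
  ∀ m → 1 ≤ m → ℤPoly.prodₚ (map Φ (divisors m)) ℤPoly.≈ₚ ℤPoly.xPowMinusOne m

record Field (c ℓ : Level) : Set (lsuc (c ⊔ ℓ)) where
  field
    commutativeRing : CommutativeRing c ℓ
  open CommutativeRing commutativeRing public
  field
    1≉0     : ¬ (1# ≈ 0#)
    inverse : ∀ x → ¬ (x ≈ 0#) → ∃ λ y → x * y ≈ 1#

module _ {c ℓ} (F : Field c ℓ) where
  open Field F
  open Poly commutativeRing

  natF : ℕ → Carrier
  natF zero    = 0#
  natF (suc n) = 1# + natF n

  -- the canonical ring map ℤ → F (reduction mod the characteristic p,
  -- followed by the inclusion of the prime field)
  intF : ℤ → Carrier
  intF (+ n)      = natF n
  intF -[1+ n ]   = - natF (suc n)

  reduceₚ : List ℤ → Pol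
  reduceₚ = map intF

  -- A finite multiplicative subgroup of F of size m, given by a
  -- duplicate-free enumeration of its elements.
  record FiniteSubgroup (m : ℕ) : Set (c ⊔ ℓ) where
    field
      elem       : Fin m → Carrier
      elem-inj   : ∀ i j → elem i ≈ elem j → i ≡ j
      one-mem    : ∃ λ i → elem i ≈ 1#
      mul-closed : ∀ i j → ∃ λ k → elem i * elem j ≈ elem k
      inv-closed : ∀ i → ∃ λ j → elem i * elem j ≈ 1#

  -- s̃(x) = s₀ x^{m-1} + s₁ x^{m-2} + ⋯ + s_{m-1}
  stilde : ∀ {m} → (Fin m → Carrier) → Pol
  stilde s = reverse (tabulate s)

  AutomaticallyNonStandard : (Φ : ℕ → List ℤ) → ∀ {m} → FiniteSubgroup m → Set (c ⊔ ℓ)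
  AutomaticallyNonStandard Φ {m} M =
    ∃ λ (π : Permutation′ m) →
      reduceₚ (Φ m) ∣ₚ stilde (λ i → FiniteSubgroup.elem M (π ⟨$⟩ʳ i))

-- Let q = r^(e-1) and m = r^e. The divisors of m other than m itself are
-- exactly the divisors of q, so the defining relation of the cyclotomic
-- family gives (x^q - 1) φ_m = x^m - 1 in ℤ[x], hence in 𝔼[x]. If φ_m
-- divided s̃, then x^m - 1 would divide (x^q - 1) s̃, say
-- (x^q - 1) s̃ = (x^m - 1) Q. As deg s̃ < m, comparing coefficients of
-- degree ≥ m shows that the coefficients of Q from degree q on are
-- m-periodic, hence zero; the coefficient of degree q then gives
-- s̃₀ = s̃_q, i.e. s_{m-1} = s_{m-1-q}, although the listing has no repetitions.
module Submission where

open import Defs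
open import Algebra.Bundles using (CommutativeRing)
open import Data.Nat using (ℕ; zero; suc; _≤_; _<_; _^_; _∸_; s≤s; NonZero)
import Data.Nat as ℕ
import Data.Nat.Properties as ℕ
open import Data.Nat.Divisibility using (_∣_; divides; _∣?_; ∣⇒≤; ∣1⇒≡1; ∣-refl; ∣n⇒∣m*n)
open import Data.Nat.Coprimality using (Coprime; coprime-divisor)
open import Data.Nat.Primality using (Prime; prime⇒irreducible; prime⇒nonZero; prime⇒nonTrivial)
open import Data.Integer using (ℤ; +_; -[1+_]; _⊖_)
import Data.Integer as ℤ
open import Data.Integer.Properties using (+-*-commutativeRing; [1+m]⊖[1+n]≡m⊖n)
open import Data.List using (List; []; _∷_; map; length; reverse; tabulate; filter; upTo; _++_)
open import Data.List.Properties
  using (filter-++; filter-accept; filter-reject; upTo-∷ʳ; unfold-reverse; length-reverse;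
         length-tabulate; ++-identityʳ; map-++)
open import Data.Fin using (Fin; toℕ; fromℕ<; opposite)
open import Data.Fin.Properties using (toℕ<n; toℕ-fromℕ<; opposite-prop; opposite-involutive)
open import Data.Fin.Permutation using (_⟨$⟩ʳ_)
open import Data.Product using (_,_)
open import Data.Sum using (_⊎_; inj₁; inj₂; [_,_]′)
open import Function using (_∘_; _⇔_; mk⇔; Injection; Equivalence)
open import Function.Properties.Inverse using (↔⇒↣)
open import Relation.Binary.Bundles using (Setoid)
open import Relation.Nullary using (¬_; yes; no)
open import Relation.Nullary.Decidable using (toSum)
open import Relation.Nullary.Negation using (contradiction)
open import Relation.Unary using (Pred; Decidable)
import Relation.Binary.PropositionalEquality as ≡
open ≡ using (_≡_)

periodic-eventually-constant :
  ∀ {a ℓ} (S : Setoid a ℓ) → let open Setoid S in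
  ∀ {f : ℕ → Carrier} {z p q L} .{{_ : NonZero p}} →
  (∀ k → q ≤ k → f k ≈ f (p ℕ.+ k)) → (∀ k → L ≤ k → f k ≈ z) → ∀ k → q ≤ k → f k ≈ z
periodic-eventually-constant S {f} {z} {p} {q} {L} periodic constant k q≤k =
  trans (iterate L k q≤k) (constant (L ℕ.* p ℕ.+ k) (ℕ.≤-trans (ℕ.m≤m*n L p) (ℕ.m≤m+n _ k)))
  where
  open Setoid S
  iterate : ∀ n k → q ≤ k → f k ≈ f (n ℕ.* p ℕ.+ k)
  iterate zero    k q≤k = refl
  iterate (suc n) k q≤k =
    trans (iterate n k q≤k)
      (trans (periodic _ (ℕ.≤-trans q≤k (ℕ.m≤n+m k _)))
             (reflexive (≡.cong f (≡.sym (ℕ.+-assoc p (n ℕ.* p) k)))))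

-- Divisors of prime powers

filter-upTo-suc : ∀ {p} {P : Pred ℕ p} (P? : Decidable P) n →
                  filter P? (upTo (suc n)) ≡ filter P? (upTo n) ++ filter P? (n ∷ [])
filter-upTo-suc P? n =
  ≡.trans (≡.cong (filter P?) (≡.sym (upTo-∷ʳ n))) (filter-++ P? (upTo n) (n ∷ []))

filter-upTo-cong : ∀ {p q} {P : Pred ℕ p} {Q : Pred ℕ q} (P? : Decidable P) (Q? : Decidable Q) {n} →
                   (∀ {x} → x < n → P x ⇔ Q x) → filter P? (upTo n) ≡ filter Q? (upTo n)
filter-upTo-cong P? Q? {zero}  P⇔Q = ≡.refl
filter-upTo-cong P? Q? {suc n} P⇔Q = begin
  filter P? (upTo (suc n))                 ≡⟨ filter-upTo-suc P? n ⟩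
  filter P? (upTo n) ++ filter P? (n ∷ [])
    ≡⟨ ≡.cong₂ _++_ (filter-upTo-cong P? Q? (P⇔Q ∘ ℕ.m<n⇒m<1+n)) last ⟩
  filter Q? (upTo n) ++ filter Q? (n ∷ []) ≡⟨ filter-upTo-suc Q? n ⟨
  filter Q? (upTo (suc n))                 ∎
  where
  open ≡.≡-Reasoning
  open Equivalence (P⇔Q ℕ.≤-refl)
  last : filter P? (n ∷ []) ≡ filter Q? (n ∷ [])
  last = [ (λ Pn → ≡.trans (filter-accept P? Pn) (≡.sym (filter-accept Q? (to Pn))))
         , (λ ¬Pn → ≡.trans (filter-reject P? ¬Pn) (≡.sym (filter-reject Q? (¬Pn ∘ from)))) ]′
         (toSum (P? n))

filter-∣-upTo : ∀ {n k} .{{_ : NonZero n}} → n < k → filter (_∣? n) (upTo k) ≡ divisors n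
filter-∣-upTo {n} {suc k} (s≤s n≤k) with ℕ.m≤n⇒m<n∨m≡n n≤k
... | inj₂ ≡.refl = ≡.refl
... | inj₁ n<k = begin
  filter (_∣? n) (upTo (suc k))                      ≡⟨ filter-upTo-suc (_∣? n) k ⟩
  filter (_∣? n) (upTo k) ++ filter (_∣? n) (k ∷ []) ≡⟨ ≡.cong₂ _++_ (filter-∣-upTo n<k) k∤n ⟩
  divisors n ++ []                                   ≡⟨ ++-identityʳ (divisors n) ⟩
  divisors n                                         ∎
  where
  open ≡.≡-Reasoning
  k∤n : filter (_∣? n) (k ∷ []) ≡ []
  k∤n = filter-reject (_∣? n) (ℕ.<⇒≱ n<k ∘ ∣⇒≤)

¬∣⇒coprime : ∀ {r k} → Prime r → ¬ r ∣ k → Coprime k r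
¬∣⇒coprime r-prime r∤k (d∣k , d∣r) with prime⇒irreducible r-prime d∣r
... | inj₁ d≡1    = d≡1
... | inj₂ ≡.refl = contradiction d∣k r∤k

coprime-∣^⇒∣1 : ∀ {k r} → Coprime k r → ∀ n → k ∣ r ^ n → k ∣ 1
coprime-∣^⇒∣1 k⊥r zero    k∣1   = k∣1
coprime-∣^⇒∣1 k⊥r (suc n) k∣r^n = coprime-∣^⇒∣1 k⊥r n (coprime-divisor k⊥r k∣r^n)

-- Write r^(n+1) = k d: either r ∣ k and d ∣ r^n, or k is coprime to r and then k = 1.
∣-prime-power : ∀ {r} → Prime r → ∀ n {d} → d ∣ r ^ suc n → d ∣ r ^ n ⊎ d ≡ r ^ suc n
∣-prime-power {r} r-prime n {d} (divides k r^[1+n]≡kd) with r ∣? k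
... | yes (divides k′ ≡.refl) =
  inj₁ (divides k′ (ℕ.*-cancelˡ-≡ _ _ r {{prime⇒nonZero r-prime}} (begin
    r ℕ.* r ^ n          ≡⟨ r^[1+n]≡kd ⟩
    (k′ ℕ.* r) ℕ.* d     ≡⟨ ≡.cong (ℕ._* d) (ℕ.*-comm k′ r) ⟩
    (r ℕ.* k′) ℕ.* d     ≡⟨ ℕ.*-assoc r k′ d ⟩
    r ℕ.* (k′ ℕ.* d)     ∎)))
  where open ≡.≡-Reasoning
... | no r∤k with ∣1⇒≡1 (coprime-∣^⇒∣1 (¬∣⇒coprime r-prime r∤k) (suc n)
                           (divides d (≡.trans r^[1+n]≡kd (ℕ.*-comm k d))))
...   | ≡.refl = inj₂ (≡.sym (≡.trans r^[1+n]≡kd (ℕ.+-identityʳ d)))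

prime⇒m^n<m^[1+n] : ∀ {r} → Prime r → ∀ n → r ^ n < r ^ suc n
prime⇒m^n<m^[1+n] {r} r-prime n =
  ℕ.^-monoʳ-< r (ℕ.nonTrivial⇒n>1 r {{prime⇒nonTrivial r-prime}}) (ℕ.n<1+n n)

divisors-prime-power : ∀ {r} → Prime r → ∀ n → divisors (r ^ suc n) ≡ divisors (r ^ n) ++ r ^ suc n ∷ []
divisors-prime-power {r} r-prime n = begin
  filter (_∣? m) (upTo (suc m))                      ≡⟨ filter-upTo-suc (_∣? m) m ⟩
  filter (_∣? m) (upTo m) ++ filter (_∣? m) (m ∷ []) ≡⟨ ≡.cong₂ _++_ below-m (filter-accept (_∣? m) ∣-refl) ⟩
  filter (_∣? q) (upTo m) ++ m ∷ []                  ≡⟨ ≡.cong (_++ m ∷ []) (filter-∣-upTo q<m) ⟩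
  divisors q ++ m ∷ []                               ∎
  where
  open ≡.≡-Reasoning
  instance
    r≢0 : NonZero r
    r≢0 = prime⇒nonZero r-prime
    q≢0 : NonZero (r ^ n)
    q≢0 = ℕ.m^n≢0 r n
  q m : ℕ
  q = r ^ n
  m = r ^ suc n
  q<m : q < m
  q<m = prime⇒m^n<m^[1+n] r-prime n
  below-m : filter (_∣? m) (upTo m) ≡ filter (_∣? q) (upTo m)
  below-m = filter-upTo-cong (_∣? m) (_∣? q) λ {x} x<m → mk⇔
    (λ x∣m → [ (λ x∣q → x∣q) , (λ { ≡.refl → contradiction x<m (ℕ.<-irrefl ≡.refl) }) ]′
               (∣-prime-power r-prime n x∣m))
    (∣n⇒∣m*n r)

-- Polynomial arithmetic over a commutative ring

module PolyProperties {c ℓ} (R : CommutativeRing c ℓ) where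
  open CommutativeRing R
  open Poly R
  open import Algebra.Properties.Ring ring using (-1*x≈-x)
  open import Algebra.Properties.CommutativeSemigroup +-commutativeSemigroup using (interchange)
  open import Relation.Binary.Reasoning.Setoid setoid

  coeff-+ₚ : ∀ p q i → coeff (p +ₚ q) i ≈ coeff p i + coeff q i
  coeff-+ₚ []      q       i       = sym (+-identityˡ _)
  coeff-+ₚ (a ∷ p) []      i       = sym (+-identityʳ _)
  coeff-+ₚ (a ∷ p) (b ∷ q) zero    = refl
  coeff-+ₚ (a ∷ p) (b ∷ q) (suc i) = coeff-+ₚ p q i

  coeff-map-* : ∀ a q i → coeff (map (a *_) q) i ≈ a * coeff q i
  coeff-map-* a []      i       = sym (zeroʳ a)
  coeff-map-* a (b ∷ q) zero    = refl
  coeff-map-* a (b ∷ q) (suc i) = coeff-map-* a q i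

  length≤⇒coeff≡0 : ∀ p {i} → length p ≤ i → coeff p i ≡ 0#
  length≤⇒coeff≡0 []      _         = ≡.refl
  length≤⇒coeff≡0 (a ∷ p) (s≤s p≤i) = length≤⇒coeff≡0 p p≤i

  coeff-reverse : ∀ xs {i} → i < length xs → coeff (reverse xs) i ≡ coeff xs (length xs ∸ suc i)
  coeff-reverse (x ∷ xs) {i} (s≤s i≤n) rewrite unfold-reverse x xs with ℕ.m≤n⇒m<n∨m≡n i≤n
  ... | inj₁ i<n =
    ≡.trans (coeff-++ˡ (reverse xs) (≡.subst (i <_) (≡.sym (length-reverse xs)) i<n))
            (≡.trans (coeff-reverse xs i<n) (≡.cong (coeff (x ∷ xs)) (≡.sym (ℕ.+-∸-assoc 1 i<n))))
    where
    coeff-++ˡ : ∀ ys {zs i} → i < length ys → coeff (ys ++ zs) i ≡ coeff ys i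
    coeff-++ˡ (y ∷ ys) {i = zero}  _         = ≡.refl
    coeff-++ˡ (y ∷ ys) {i = suc i} (s≤s i<n) = coeff-++ˡ ys i<n
  ... | inj₂ ≡.refl =
    ≡.trans (≡.subst (λ k → coeff (reverse xs ++ x ∷ []) k ≡ x) (length-reverse xs)
                     (coeff-++-length (reverse xs)))
            (≡.cong (coeff (x ∷ xs)) (≡.sym (ℕ.n∸n≡0 (length xs))))
    where
    coeff-++-length : ∀ ys {zs} → coeff (ys ++ x ∷ zs) (length ys) ≡ x
    coeff-++-length []       = ≡.refl
    coeff-++-length (y ∷ ys) = coeff-++-length ys

  coeff-tabulate : ∀ {n} (s : Fin n → Carrier) i → coeff (tabulate s) (toℕ i) ≡ s i
  coeff-tabulate s Fin.zero    = ≡.refl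
  coeff-tabulate s (Fin.suc i) = coeff-tabulate (s ∘ Fin.suc) i

  coeff-reverse-tabulate : ∀ {n} (s : Fin n → Carrier) i →
                           coeff (reverse (tabulate s)) (toℕ i) ≡ s (opposite i)
  coeff-reverse-tabulate s i =
    ≡.trans (coeff-reverse (tabulate s) (≡.subst (toℕ i <_) (≡.sym (length-tabulate s)) (toℕ<n i)))
    (≡.trans (≡.cong (λ k → coeff (tabulate s) (k ∸ suc (toℕ i))) (length-tabulate s))
    (≡.trans (≡.cong (coeff (tabulate s)) (≡.sym (opposite-prop i)))
             (coeff-tabulate s (opposite i))))

  -- conv f g i = ∑_{j ≤ i} f j * g (i ∸ j), unfolded along f
  conv : (ℕ → Carrier) → (ℕ → Carrier) → ℕ → Carrier
  conv f g zero    = f 0 * g 0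
  conv f g (suc i) = f 0 * g (suc i) + conv (f ∘ suc) g i

  conv-cong : ∀ {f f′ g g′} → (∀ j → f j ≈ f′ j) → (∀ j → g j ≈ g′ j) →
              ∀ i → conv f g i ≈ conv f′ g′ i
  conv-cong f≈f′ g≈g′ zero    = *-cong (f≈f′ 0) (g≈g′ 0)
  conv-cong f≈f′ g≈g′ (suc i) = +-cong (*-cong (f≈f′ 0) (g≈g′ (suc i))) (conv-cong (f≈f′ ∘ suc) g≈g′ i)

  conv-zeroˡ : ∀ {f} g → (∀ j → f j ≈ 0#) → ∀ i → conv f g i ≈ 0#
  conv-zeroˡ g f≈0 zero    = trans (*-congʳ (f≈0 0)) (zeroˡ _)
  conv-zeroˡ g f≈0 (suc i) =
    trans (+-cong (trans (*-congʳ (f≈0 0)) (zeroˡ _)) (conv-zeroˡ g (f≈0 ∘ suc) i)) (+-identityˡ 0#)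

  coeff-*ₚ : ∀ p q i → coeff (p *ₚ q) i ≈ conv (coeff p) (coeff q) i
  coeff-*ₚ []      q i       = sym (conv-zeroˡ (coeff q) (λ _ → refl) i)
  coeff-*ₚ (a ∷ p) q zero    =
    trans (coeff-+ₚ (map (a *_) q) _ 0) (trans (+-identityʳ _) (coeff-map-* a q 0))
  coeff-*ₚ (a ∷ p) q (suc i) =
    trans (coeff-+ₚ (map (a *_) q) _ (suc i)) (+-cong (coeff-map-* a q (suc i)) (coeff-*ₚ p q i))

  conv-distribʳ : ∀ f f′ g i → conv (λ j → f j + f′ j) g i ≈ conv f g i + conv f′ g i
  conv-distribʳ f f′ g zero    = distribʳ _ _ _
  conv-distribʳ f f′ g (suc i) =
    trans (+-cong (distribʳ _ _ _) (conv-distribʳ (f ∘ suc) (f′ ∘ suc) g i)) (interchange _ _ _ _)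

  conv-scaleˡ : ∀ a f g i → conv (λ j → a * f j) g i ≈ a * conv f g i
  conv-scaleˡ a f g zero    = *-assoc _ _ _
  conv-scaleˡ a f g (suc i) =
    trans (+-cong (*-assoc _ _ _) (conv-scaleˡ a (f ∘ suc) g i)) (sym (distribˡ _ _ _))

  conv-assoc : ∀ f g h i → conv f (conv g h) i ≈ conv (conv f g) h i
  conv-assoc f g h zero    = sym (*-assoc _ _ _)
  conv-assoc f g h (suc i) = begin
    f 0 * (g 0 * h (suc i) + conv (g ∘ suc) h i) + conv (f ∘ suc) (conv g h) i
      ≈⟨ +-congʳ (distribˡ _ _ _) ⟩
    (f 0 * (g 0 * h (suc i)) + f 0 * conv (g ∘ suc) h i) + conv (f ∘ suc) (conv g h) i
      ≈⟨ +-assoc _ _ _ ⟩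
    f 0 * (g 0 * h (suc i)) + (f 0 * conv (g ∘ suc) h i + conv (f ∘ suc) (conv g h) i)
      ≈⟨ +-cong (sym (*-assoc _ _ _))
                (+-cong (sym (conv-scaleˡ (f 0) (g ∘ suc) h i)) (conv-assoc (f ∘ suc) g h i)) ⟩
    (f 0 * g 0) * h (suc i) + (conv (λ j → f 0 * g (suc j)) h i + conv (conv (f ∘ suc) g) h i)
      ≈⟨ +-congˡ (conv-distribʳ (λ j → f 0 * g (suc j)) (conv (f ∘ suc) g) h i) ⟨
    (f 0 * g 0) * h (suc i) + conv (conv f g ∘ suc) h i
      ∎

  conv-constˡ : ∀ a g i → conv (coeff (a ∷ [])) g i ≈ a * g i
  conv-constˡ a g zero    = refl
  conv-constˡ a g (suc i) = trans (+-congˡ (conv-zeroˡ g (λ _ → refl) i)) (+-identityʳ _)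

  conv-identityʳ : ∀ f i → conv f (coeff oneₚ) i ≈ f i
  conv-identityʳ f zero    = *-identityʳ _
  conv-identityʳ f (suc i) = trans (+-cong (zeroʳ _) (conv-identityʳ (f ∘ suc) i)) (+-identityˡ _)

  conv-xPowˡ-< : ∀ k g {i} → i < k → conv (coeff (xPow k)) g i ≈ 0#
  conv-xPowˡ-< (suc k) g {zero}  _         = zeroˡ _
  conv-xPowˡ-< (suc k) g {suc i} (s≤s i<k) = trans (+-cong (zeroˡ _) (conv-xPowˡ-< k g i<k)) (+-identityˡ _)

  conv-xPowˡ-+ : ∀ k g j → conv (coeff (xPow k)) g (k ℕ.+ j) ≈ g j
  conv-xPowˡ-+ zero    g j = trans (conv-constˡ 1# g j) (*-identityˡ _)
  conv-xPowˡ-+ (suc k) g j = trans (+-cong (zeroˡ _) (conv-xPowˡ-+ k g j)) (+-identityˡ _)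

  conv-xPowMinusOneˡ : ∀ k g i → conv (coeff (xPowMinusOne k)) g i ≈ conv (coeff (xPow k)) g i + - g i
  conv-xPowMinusOneˡ k g i = begin
    conv (coeff (xPowMinusOne k)) g i
      ≈⟨ conv-cong (coeff-+ₚ (xPow k) _) (λ _ → refl) i ⟩
    conv (λ j → coeff (xPow k) j + coeff ((- 1#) ∷ []) j) g i
      ≈⟨ conv-distribʳ (coeff (xPow k)) _ g i ⟩
    conv (coeff (xPow k)) g i + conv (coeff ((- 1#) ∷ [])) g i
      ≈⟨ +-congˡ (trans (conv-constˡ (- 1#) g i) (-1*x≈-x (g i))) ⟩
    conv (coeff (xPow k)) g i + - g i
      ∎

  *ₚ-cong : ∀ p p′ q q′ → p ≈ₚ p′ → q ≈ₚ q′ → p *ₚ q ≈ₚ p′ *ₚ q′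
  *ₚ-cong p p′ q q′ p≈p′ q≈q′ i = begin
    coeff (p *ₚ q) i             ≈⟨ coeff-*ₚ p q i ⟩
    conv (coeff p) (coeff q) i   ≈⟨ conv-cong p≈p′ q≈q′ i ⟩
    conv (coeff p′) (coeff q′) i ≈⟨ coeff-*ₚ p′ q′ i ⟨
    coeff (p′ *ₚ q′) i           ∎

  *ₚ-assoc : ∀ p q r → (p *ₚ q) *ₚ r ≈ₚ p *ₚ (q *ₚ r)
  *ₚ-assoc p q r i = begin
    coeff ((p *ₚ q) *ₚ r) i                   ≈⟨ coeff-*ₚ (p *ₚ q) r i ⟩
    conv (coeff (p *ₚ q)) (coeff r) i         ≈⟨ conv-cong (coeff-*ₚ p q) (λ _ → refl) i ⟩
    conv (conv (coeff p) (coeff q)) (coeff r) i ≈⟨ conv-assoc (coeff p) (coeff q) (coeff r) i ⟨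
    conv (coeff p) (conv (coeff q) (coeff r)) i ≈⟨ conv-cong (λ _ → refl) (coeff-*ₚ q r) i ⟨
    conv (coeff p) (coeff (q *ₚ r)) i         ≈⟨ coeff-*ₚ p (q *ₚ r) i ⟨
    coeff (p *ₚ (q *ₚ r)) i                   ∎

  *ₚ-identityˡ : ∀ p → oneₚ *ₚ p ≈ₚ p
  *ₚ-identityˡ p i = trans (coeff-*ₚ oneₚ p i) (trans (conv-constˡ 1# (coeff p) i) (*-identityˡ _))

  *ₚ-identityʳ : ∀ p → p *ₚ oneₚ ≈ₚ p
  *ₚ-identityʳ p i = trans (coeff-*ₚ p oneₚ i) (conv-identityʳ (coeff p) i)

  prodₚ-∷ʳ : ∀ ps p → prodₚ (ps ++ p ∷ []) ≈ₚ prodₚ ps *ₚ p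
  prodₚ-∷ʳ []       p i = trans (*ₚ-identityʳ p i) (sym (*ₚ-identityˡ p i))
  prodₚ-∷ʳ (q ∷ ps) p i =
    trans (*ₚ-cong q q _ _ (λ _ → refl) (prodₚ-∷ʳ ps p) i) (sym (*ₚ-assoc q (prodₚ ps) p i))

  *ₚ-monoʳ-∣ₚ : ∀ p {f g} → f ∣ₚ g → p *ₚ f ∣ₚ p *ₚ g
  *ₚ-monoʳ-∣ₚ p {f} {g} (h , fh≈g) =
    h , λ i → trans (*ₚ-assoc p f h i) (*ₚ-cong p p (f *ₚ h) g (λ _ → refl) fh≈g i)

  ∣ₚ-respˡ-≈ₚ : ∀ f f′ g → f ≈ₚ f′ → f ∣ₚ g → f′ ∣ₚ g
  ∣ₚ-respˡ-≈ₚ f f′ g f≈f′ (h , fh≈g) =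
    h , λ i → trans (*ₚ-cong f′ f h h (sym ∘ f≈f′) (λ _ → refl) i) (fh≈g i)

  coeff-xPowMinusOne-*ₚ-< : ∀ k g {i} → i < k → coeff (xPowMinusOne k *ₚ g) i ≈ - coeff g i
  coeff-xPowMinusOne-*ₚ-< k g {i} i<k = begin
    coeff (xPowMinusOne k *ₚ g) i                      ≈⟨ coeff-*ₚ (xPowMinusOne k) g i ⟩
    conv (coeff (xPowMinusOne k)) (coeff g) i          ≈⟨ conv-xPowMinusOneˡ k (coeff g) i ⟩
    conv (coeff (xPow k)) (coeff g) i + - coeff g i    ≈⟨ +-congʳ (conv-xPowˡ-< k (coeff g) i<k) ⟩
    0# + - coeff g i                                   ≈⟨ +-identityˡ _ ⟩
    - coeff g i                                        ∎

  coeff-xPowMinusOne-*ₚ-+ : ∀ k g j →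
    coeff (xPowMinusOne k *ₚ g) (k ℕ.+ j) ≈ coeff g j + - coeff g (k ℕ.+ j)
  coeff-xPowMinusOne-*ₚ-+ k g j = begin
    coeff (xPowMinusOne k *ₚ g) (k ℕ.+ j)                         ≈⟨ coeff-*ₚ (xPowMinusOne k) g _ ⟩
    conv (coeff (xPowMinusOne k)) (coeff g) (k ℕ.+ j)             ≈⟨ conv-xPowMinusOneˡ k (coeff g) _ ⟩
    conv (coeff (xPow k)) (coeff g) (k ℕ.+ j) + - coeff g (k ℕ.+ j) ≈⟨ +-congʳ (conv-xPowˡ-+ k (coeff g) j) ⟩
    coeff g j + - coeff g (k ℕ.+ j)                               ∎

  xPowMinusOne-∣ₚ⇒coeff-0≈coeff : ∀ {q m} s → q < m → length s ≤ m →
    xPowMinusOne m ∣ₚ xPowMinusOne q *ₚ s → coeff s 0 ≈ coeff s q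
  xPowMinusOne-∣ₚ⇒coeff-0≈coeff {q} {m} s q<m deg-s<m (Q , eq) =
    ≡.subst (λ i → coeff s 0 ≈ coeff s i) (ℕ.+-identityʳ q) (x∙y⁻¹≈ε⇒x≈y _ _ (begin
      coeff s 0 + - coeff s (q ℕ.+ 0)     ≈⟨ coeff-xPowMinusOne-*ₚ-+ q s 0 ⟨
      coeff (xPowMinusOne q *ₚ s) (q ℕ.+ 0) ≈⟨ eq (q ℕ.+ 0) ⟨
      coeff (xPowMinusOne m *ₚ Q) (q ℕ.+ 0) ≈⟨ coeff-xPowMinusOne-*ₚ-< m Q q+0<m ⟩
      - coeff Q (q ℕ.+ 0)                 ≈⟨ -‿cong (Q-vanishes (q ℕ.+ 0) (ℕ.m≤m+n q 0)) ⟩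
      - 0#                                ≈⟨ ε⁻¹≈ε ⟩
      0#                                  ∎))
    where
    open import Algebra.Properties.Group +-group using (x∙y⁻¹≈ε⇒x≈y; ε⁻¹≈ε)
    instance
      m≢0 : NonZero m
      m≢0 = ℕ.>-nonZero (ℕ.≤-<-trans ℕ.z≤n q<m)
    q+0<m : q ℕ.+ 0 < m
    q+0<m = ≡.subst (_< m) (≡.sym (ℕ.+-identityʳ q)) q<m
    w : ℕ
    w = m ∸ q
    q+w≡m : q ℕ.+ w ≡ m
    q+w≡m = ℕ.m+[n∸m]≡n (ℕ.<⇒≤ q<m)
    s-vanishes : ∀ {i} → m ≤ i → coeff s i ≈ 0#
    s-vanishes m≤i = reflexive (length≤⇒coeff≡0 s (ℕ.≤-trans deg-s<m m≤i))
    Q-periodic : ∀ k → q ≤ k → coeff Q k ≈ coeff Q (m ℕ.+ k)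
    Q-periodic k q≤k = x∙y⁻¹≈ε⇒x≈y _ _ (begin
      coeff Q k + - coeff Q (m ℕ.+ k)             ≈⟨ coeff-xPowMinusOne-*ₚ-+ m Q k ⟨
      coeff (xPowMinusOne m *ₚ Q) (m ℕ.+ k)       ≈⟨ eq (m ℕ.+ k) ⟩
      coeff (xPowMinusOne q *ₚ s) (m ℕ.+ k)       ≡⟨ ≡.cong (coeff (xPowMinusOne q *ₚ s)) m+k≡q+[w+k] ⟩
      coeff (xPowMinusOne q *ₚ s) (q ℕ.+ (w ℕ.+ k)) ≈⟨ coeff-xPowMinusOne-*ₚ-+ q s (w ℕ.+ k) ⟩
      coeff s (w ℕ.+ k) + - coeff s (q ℕ.+ (w ℕ.+ k))
        ≈⟨ +-cong (s-vanishes m≤w+k) (-‿cong (s-vanishes (≡.subst (m ≤_) m+k≡q+[w+k] (ℕ.m≤m+n m k)))) ⟩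
      0# + - 0#                                   ≈⟨ -‿inverseʳ 0# ⟩
      0#                                          ∎)
      where
      m+k≡q+[w+k] : m ℕ.+ k ≡ q ℕ.+ (w ℕ.+ k)
      m+k≡q+[w+k] = ≡.trans (≡.cong (ℕ._+ k) (≡.sym q+w≡m)) (ℕ.+-assoc q w k)
      m≤w+k : m ≤ w ℕ.+ k
      m≤w+k = ≡.subst (_≤ w ℕ.+ k) (≡.trans (ℕ.+-comm w q) q+w≡m) (ℕ.+-monoʳ-≤ w q≤k)
    Q-vanishes : ∀ k → q ≤ k → coeff Q k ≈ 0#
    Q-vanishes = periodic-eventually-constant setoid Q-periodic
                   (λ k len≤k → reflexive (length≤⇒coeff≡0 Q len≤k))

-- Reduction of integer polynomials into a field

module ℤPolyProperties = PolyProperties +-*-commutativeRing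

module Reduction {c ℓ} (F : Field c ℓ) where
  open Field F
  open Poly commutativeRing
  open PolyProperties commutativeRing
  open import Algebra.Properties.Group +-group using (ε⁻¹≈ε; ⁻¹-involutive)
  open import Algebra.Properties.AbelianGroup +-abelianGroup using (⁻¹-∙-comm)
  open import Algebra.Properties.CommutativeSemigroup +-commutativeSemigroup using (interchange)
  open import Relation.Binary.Reasoning.Setoid setoid

  natF-+ : ∀ m n → natF F (m ℕ.+ n) ≈ natF F m + natF F n
  natF-+ zero    n = sym (+-identityˡ _)
  natF-+ (suc m) n = trans (+-congˡ (natF-+ m n)) (sym (+-assoc _ _ _))

  intF-⊖ : ∀ m n → intF F (m ⊖ n) ≈ natF F m + - natF F n
  intF-⊖ m       zero    = sym (trans (+-congˡ ε⁻¹≈ε) (+-identityʳ _))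
  intF-⊖ zero    (suc n) = sym (+-identityˡ _)
  intF-⊖ (suc m) (suc n) rewrite [1+m]⊖[1+n]≡m⊖n m n = begin
    intF F (m ⊖ n)                                ≈⟨ intF-⊖ m n ⟩
    natF F m + - natF F n                         ≈⟨ +-identityˡ _ ⟨
    0# + (natF F m + - natF F n)                  ≈⟨ +-congʳ (-‿inverseʳ 1#) ⟨
    (1# + - 1#) + (natF F m + - natF F n)         ≈⟨ interchange _ _ _ _ ⟩
    (1# + natF F m) + (- 1# + - natF F n)         ≈⟨ +-congˡ (⁻¹-∙-comm 1# (natF F n)) ⟩
    (1# + natF F m) + - (1# + natF F n)           ∎

  intF-+ : ∀ a b → intF F (a ℤ.+ b) ≈ intF F a + intF F b
  intF-+ (+ m)    (+ n)    = natF-+ m n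
  intF-+ (+ m)    -[1+ n ] = intF-⊖ m (suc n)
  intF-+ -[1+ m ] (+ n)    = trans (intF-⊖ n (suc m)) (+-comm _ _)
  intF-+ -[1+ m ] -[1+ n ] = begin
    - (1# + natF F (suc (m ℕ.+ n)))         ≈⟨ -‿cong (+-congˡ (+-congˡ (natF-+ m n))) ⟩
    - (1# + (1# + (natF F m + natF F n)))   ≈⟨ -‿cong (trans (interchange _ _ _ _) (+-assoc _ _ _)) ⟨
    - ((1# + natF F m) + (1# + natF F n))   ≈⟨ ⁻¹-∙-comm _ _ ⟨
    - (1# + natF F m) + - (1# + natF F n)   ∎

  intF-neg : ∀ a → intF F (ℤ.- a) ≈ - intF F a
  intF-neg (+ zero)  = sym ε⁻¹≈ε
  intF-neg (+ suc n) = refl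
  intF-neg -[1+ n ]  = sym (⁻¹-involutive _)

  coeff-reduceₚ : ∀ p i → coeff (reduceₚ F p) i ≡ intF F (ℤPoly.coeff p i)
  coeff-reduceₚ []      i       = ≡.refl
  coeff-reduceₚ (a ∷ p) zero    = ≡.refl
  coeff-reduceₚ (a ∷ p) (suc i) = coeff-reduceₚ p i

  reduceₚ-cong : ∀ p p′ → p ℤPoly.≈ₚ p′ → reduceₚ F p ≈ₚ reduceₚ F p′
  reduceₚ-cong p p′ p≈p′ i = begin
    coeff (reduceₚ F p) i       ≡⟨ coeff-reduceₚ p i ⟩
    intF F (ℤPoly.coeff p i)    ≡⟨ ≡.cong (intF F) (p≈p′ i) ⟩
    intF F (ℤPoly.coeff p′ i)   ≡⟨ coeff-reduceₚ p′ i ⟨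
    coeff (reduceₚ F p′) i      ∎

  reduceₚ-+ₚ : ∀ p q → reduceₚ F (p ℤPoly.+ₚ q) ≈ₚ reduceₚ F p +ₚ reduceₚ F q
  reduceₚ-+ₚ p q i = begin
    coeff (reduceₚ F (p ℤPoly.+ₚ q)) i                 ≡⟨ coeff-reduceₚ (p ℤPoly.+ₚ q) i ⟩
    intF F (ℤPoly.coeff (p ℤPoly.+ₚ q) i)              ≡⟨ ≡.cong (intF F) (ℤPolyProperties.coeff-+ₚ p q i) ⟩
    intF F (ℤPoly.coeff p i ℤ.+ ℤPoly.coeff q i)       ≈⟨ intF-+ (ℤPoly.coeff p i) (ℤPoly.coeff q i) ⟩
    intF F (ℤPoly.coeff p i) + intF F (ℤPoly.coeff q i) ≡⟨ ≡.cong₂ _+_ (coeff-reduceₚ p i) (coeff-reduceₚ q i) ⟨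
    coeff (reduceₚ F p) i + coeff (reduceₚ F q) i      ≈⟨ coeff-+ₚ (reduceₚ F p) (reduceₚ F q) i ⟨
    coeff (reduceₚ F p +ₚ reduceₚ F q) i               ∎

  reduceₚ-xPow : ∀ k → reduceₚ F (ℤPoly.xPow k) ≈ₚ xPow k
  reduceₚ-xPow zero    zero    = +-identityʳ 1#
  reduceₚ-xPow zero    (suc i) = refl
  reduceₚ-xPow (suc k) zero    = refl
  reduceₚ-xPow (suc k) (suc i) = reduceₚ-xPow k i

  reduceₚ-xPowMinusOne : ∀ k → reduceₚ F (ℤPoly.xPowMinusOne k) ≈ₚ xPowMinusOne k
  reduceₚ-xPowMinusOne k i = begin
    coeff (reduceₚ F (ℤPoly.xPowMinusOne k)) i                          ≈⟨ reduceₚ-+ₚ (ℤPoly.xPow k) _ i ⟩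
    coeff (reduceₚ F (ℤPoly.xPow k) +ₚ reduceₚ F (-[1+ 0 ] ∷ [])) i     ≈⟨ coeff-+ₚ (reduceₚ F (ℤPoly.xPow k)) _ i ⟩
    coeff (reduceₚ F (ℤPoly.xPow k)) i + coeff (reduceₚ F (-[1+ 0 ] ∷ [])) i
      ≈⟨ +-cong (reduceₚ-xPow k i) (reduce-[-1] i) ⟩
    coeff (xPow k) i + coeff ((- 1#) ∷ []) i                           ≈⟨ coeff-+ₚ (xPow k) _ i ⟨
    coeff (xPowMinusOne k) i                                           ∎
    where
    reduce-[-1] : reduceₚ F (-[1+ 0 ] ∷ []) ≈ₚ (- 1#) ∷ []
    reduce-[-1] zero    = -‿cong (+-identityʳ 1#)
    reduce-[-1] (suc i) = refl

  reduceₚ-xPowMinusOne-*ₚ : ∀ k p →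
    reduceₚ F (ℤPoly.xPowMinusOne k ℤPoly.*ₚ p) ≈ₚ xPowMinusOne k *ₚ reduceₚ F p
  reduceₚ-xPowMinusOne-*ₚ k p i with i ℕ.<? k
  ... | yes i<k = begin
    coeff (reduceₚ F (ℤPoly.xPowMinusOne k ℤPoly.*ₚ p)) i
      ≡⟨ coeff-reduceₚ (ℤPoly.xPowMinusOne k ℤPoly.*ₚ p) i ⟩
    intF F (ℤPoly.coeff (ℤPoly.xPowMinusOne k ℤPoly.*ₚ p) i)
      ≡⟨ ≡.cong (intF F) (ℤPolyProperties.coeff-xPowMinusOne-*ₚ-< k p i<k) ⟩
    intF F (ℤ.- ℤPoly.coeff p i)
      ≈⟨ intF-neg (ℤPoly.coeff p i) ⟩
    - intF F (ℤPoly.coeff p i)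
      ≡⟨ ≡.cong -_ (coeff-reduceₚ p i) ⟨
    - coeff (reduceₚ F p) i
      ≈⟨ coeff-xPowMinusOne-*ₚ-< k (reduceₚ F p) i<k ⟨
    coeff (xPowMinusOne k *ₚ reduceₚ F p) i
      ∎
  ... | no i≮k with ℕ.m≤n⇒∃[o]m+o≡n (ℕ.≮⇒≥ i≮k)
  ...   | j , ≡.refl = begin
    coeff (reduceₚ F (ℤPoly.xPowMinusOne k ℤPoly.*ₚ p)) (k ℕ.+ j)
      ≡⟨ coeff-reduceₚ (ℤPoly.xPowMinusOne k ℤPoly.*ₚ p) (k ℕ.+ j) ⟩
    intF F (ℤPoly.coeff (ℤPoly.xPowMinusOne k ℤPoly.*ₚ p) (k ℕ.+ j))
      ≡⟨ ≡.cong (intF F) (ℤPolyProperties.coeff-xPowMinusOne-*ₚ-+ k p j) ⟩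
    intF F (ℤPoly.coeff p j ℤ.+ ℤ.- ℤPoly.coeff p (k ℕ.+ j))
      ≈⟨ intF-+ (ℤPoly.coeff p j) _ ⟩
    intF F (ℤPoly.coeff p j) + intF F (ℤ.- ℤPoly.coeff p (k ℕ.+ j))
      ≈⟨ +-congˡ (intF-neg (ℤPoly.coeff p (k ℕ.+ j))) ⟩
    intF F (ℤPoly.coeff p j) + - intF F (ℤPoly.coeff p (k ℕ.+ j))
      ≡⟨ ≡.cong₂ (λ a b → a + - b) (coeff-reduceₚ p j) (coeff-reduceₚ p (k ℕ.+ j)) ⟨
    coeff (reduceₚ F p) j + - coeff (reduceₚ F p) (k ℕ.+ j)
      ≈⟨ coeff-xPowMinusOne-*ₚ-+ k (reduceₚ F p) j ⟨
    coeff (xPowMinusOne k *ₚ reduceₚ F p) (k ℕ.+ j)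
      ∎

-- Cyclotomic polynomials of prime-power order

cyclotomic-prime-power : ∀ {Φ} → IsCyclotomicFamily Φ → ∀ {r} → Prime r → ∀ n →
  ℤPoly.xPowMinusOne (r ^ n) ℤPoly.*ₚ Φ (r ^ suc n) ℤPoly.≈ₚ ℤPoly.xPowMinusOne (r ^ suc n)
cyclotomic-prime-power {Φ} cyclotomic {r} r-prime n i = begin
  coeff (xPowMinusOne q *ₚ Φ m) i
    ≡⟨ *ₚ-cong (xPowMinusOne q) (prodₚ (map Φ (divisors q))) (Φ m) (Φ m)
               (≡.sym ∘ cyclotomic q (ℕ.m^n>0 r n)) (λ _ → ≡.refl) i ⟩
  coeff (prodₚ (map Φ (divisors q)) *ₚ Φ m) i
    ≡⟨ prodₚ-∷ʳ (map Φ (divisors q)) (Φ m) i ⟨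
  coeff (prodₚ (map Φ (divisors q) ++ Φ m ∷ [])) i
    ≡⟨ ≡.cong (λ ds → coeff (prodₚ ds) i) (map-++ Φ (divisors q) (m ∷ [])) ⟨
  coeff (prodₚ (map Φ (divisors q ++ m ∷ []))) i
    ≡⟨ ≡.cong (λ ds → coeff (prodₚ (map Φ ds)) i) (divisors-prime-power r-prime n) ⟨
  coeff (prodₚ (map Φ (divisors m))) i
    ≡⟨ cyclotomic m (ℕ.m^n>0 r (suc n)) i ⟩
  coeff (xPowMinusOne m) i
    ∎
  where
  open ≡.≡-Reasoning
  open ℤPoly
  open ℤPolyProperties
  instance
    r≢0 : NonZero r
    r≢0 = prime⇒nonZero r-prime
  q m : ℕ
  q = r ^ n
  m = r ^ suc n

module _ {c ℓ} (F : Field c ℓ) where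
  open Field F
  open Poly commutativeRing
  open PolyProperties commutativeRing
  open Reduction F

  reduced-cyclotomic-prime-power : ∀ {Φ} → IsCyclotomicFamily Φ → ∀ {r} → Prime r → ∀ n →
    xPowMinusOne (r ^ n) *ₚ reduceₚ F (Φ (r ^ suc n)) ≈ₚ xPowMinusOne (r ^ suc n)
  reduced-cyclotomic-prime-power {Φ} cyclotomic {r} r-prime n i = begin
    coeff (xPowMinusOne q *ₚ reduceₚ F (Φ m)) i
      ≈⟨ reduceₚ-xPowMinusOne-*ₚ q (Φ m) i ⟨
    coeff (reduceₚ F (ℤPoly.xPowMinusOne q ℤPoly.*ₚ Φ m)) i
      ≈⟨ reduceₚ-cong (ℤPoly.xPowMinusOne q ℤPoly.*ₚ Φ m) (ℤPoly.xPowMinusOne m)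
                      (cyclotomic-prime-power cyclotomic r-prime n) i ⟩
    coeff (reduceₚ F (ℤPoly.xPowMinusOne m)) i
      ≈⟨ reduceₚ-xPowMinusOne m i ⟩
    coeff (xPowMinusOne m) i
      ∎
    where
    open import Relation.Binary.Reasoning.Setoid setoid
    q m : ℕ
    q = r ^ n
    m = r ^ suc n

  stilde-coeff-injective : ∀ {m} {s : Fin m → Carrier} → (∀ i j → s i ≈ s j → i ≡ j) →
    ∀ {i j} (i<m : i < m) (j<m : j < m) → coeff (stilde F s) i ≈ coeff (stilde F s) j → i ≡ j
  stilde-coeff-injective {s = s} s-injective {i} {j} i<m j<m s̃ᵢ≈s̃ⱼ = begin
    i                  ≡⟨ toℕ-fromℕ< i<m ⟨
    toℕ a              ≡⟨ ≡.cong toℕ a≡b ⟩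
    toℕ b              ≡⟨ toℕ-fromℕ< j<m ⟩
    j                  ∎
    where
    open ≡.≡-Reasoning
    a b : Fin _
    a = fromℕ< i<m
    b = fromℕ< j<m
    coeff-s̃ : ∀ {k} (k<m : k < _) → coeff (stilde F s) k ≡ s (opposite (fromℕ< k<m))
    coeff-s̃ {k} k<m = ≡.trans (≡.cong (coeff (stilde F s)) (≡.sym (toℕ-fromℕ< k<m)))
                                (coeff-reverse-tabulate s (fromℕ< k<m))
    a≡b : a ≡ b
    a≡b = ≡.trans (≡.sym (opposite-involutive a))
            (≡.trans (≡.cong opposite (s-injective _ _ (trans (reflexive (≡.sym (coeff-s̃ i<m)))
                                                        (trans s̃ᵢ≈s̃ⱼ (reflexive (coeff-s̃ j<m))))))
                     (opposite-involutive b))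

mainTheorem4 : ∀ {c ℓ} (F : Field c ℓ) (Φ : ℕ → List ℤ) → IsCyclotomicFamily Φ →
    (r e : ℕ) → Prime r → 1 ≤ e →
    (M : FiniteSubgroup F (r ^ e)) →
    ¬ AutomaticallyNonStandard F Φ M
mainTheorem4 F Φ cyclotomic r (suc n) r-prime _ M (π , φ∣s̃) =
  ℕ.<⇒≢ (ℕ.m^n>0 r n) (stilde-coeff-injective F s-injective (ℕ.m^n>0 r (suc n)) q<m s̃₀≈s̃_q)
  where
  open Field F
  open Poly commutativeRing
  open PolyProperties commutativeRing
  instance
    r≢0 : NonZero r
    r≢0 = prime⇒nonZero r-prime
  q m : ℕ
  q = r ^ n
  m = r ^ suc n
  q<m : q < m
  q<m = prime⇒m^n<m^[1+n] r-prime n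
  s : Fin m → Carrier
  s i = FiniteSubgroup.elem M (π ⟨$⟩ʳ i)
  s-injective : ∀ i j → s i ≈ s j → i ≡ j
  s-injective i j = Injection.injective (↔⇒↣ π) ∘ FiniteSubgroup.elem-inj M _ _
  s̃₀≈s̃_q : coeff (stilde F s) 0 ≈ coeff (stilde F s) q
  s̃₀≈s̃_q = xPowMinusOne-∣ₚ⇒coeff-0≈coeff (stilde F s) q<m
              (ℕ.≤-reflexive (≡.trans (length-reverse (tabulate s)) (length-tabulate s)))
              (∣ₚ-respˡ-≈ₚ (xPowMinusOne q *ₚ reduceₚ F (Φ m)) (xPowMinusOne m)
                           (xPowMinusOne q *ₚ stilde F s)
                           (reduced-cyclotomic-prime-power F cyclotomic r-prime n)
                           (*ₚ-monoʳ-∣ₚ (xPowMinusOne q) φ∣s̃))
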